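{- Let $G$ be a finite group, $H$ a normal subgroup of $G$ and $g,h\in G$. Then (i) $\eta_g(\eta_g(H))=\eta_g(H)$; (ii) $\eta_{gh}(H)\leq\eta_g(H)\eta_h(H)$; (iii) if $G$ is solvable, the Fitting length of $\eta_{gh}(H)$ is at most the maximum of the Fitting lengths of $\eta_g(H)$ and $\eta_h(H)$.
   Context: Commutators $[x,y]=x^{ -1}y^{ -1}xy$; for subsets $X,Y\subseteq G$, $[X,Y]=\langle[x,y]:x\in X,y\in Y\rangle$, left-normed for iterated commutators; $[X,{}_kY]$ denotes $[X,Y,\dots,Y]$ with $k$ copies of $Y$. $g^G$ is the conjugacy class of $g$. Fix $M=M(G)$ such that $[X,{}_MY]=[X,{}_iY]$ for all $i\geq M$ and all conjugation-invariant $X,Y\subseteq G$ (e.g. $M=|G|$). For a normal subgroup $N$ and $g\in G$, $\eta_g(N)=[N,{}_Mg^G]$ (a normal subgroup of $G$ contained in $N$). The Fitting length of a finite solvable group is the minimal $d$ such that there is a normal series of length $d$ with nilpotent factors. -}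

module Defs where

open import Data.Nat using (ℕ; zero; suc; _<_; _≤_; _⊔_)
open import Data.Fin using (Fin)
open import Data.Product using (Σ; ∃; ∃-syntax; _×_; _,_)
open import Relation.Binary.PropositionalEquality using (_≡_)
open import Relation.Unary using (Pred; _⊆_; _∈_)
open import Algebra.Core using (Op₁; Op₂)
open import Algebra.Structures using (IsGroup)

-- A finite group: the carrier is Fin order (every finite group is
-- isomorphic to one of this form), with the stdlib notion of group
-- w.r.t. propositional equality.
record FiniteGroup : Set₁ where
  field
    order   : ℕ
    _∙_     : Op₂ (Fin order)
    ε       : Fin order
    _⁻¹     : Op₁ (Fin order)
    isGroup : IsGroup _≡_ _∙_ ε _⁻¹
  Carrier : Set
  Carrier = Fin order

module GroupTheory (G : FiniteGroup) where
  open FiniteGroup G public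

  infixl 7 _·_
  _·_ : Carrier → Carrier → Carrier
  _·_ = _∙_

  Subset : Set₁
  Subset = Pred Carrier _

  _≐_ : Subset → Subset → Set
  X ≐ Y = (X ⊆ Y) × (Y ⊆ X)

  comm : Carrier → Carrier → Carrier
  comm x y = ((x ⁻¹ · y ⁻¹) · x) · y

  conj : Carrier → Carrier → Carrier
  conj x a = (a ⁻¹ · x) · a

  data ⟨_⟩ (S : Subset) : Subset where
    gen  : ∀ {x} → S x → ⟨ S ⟩ x
    unit : ⟨ S ⟩ ε
    mul  : ∀ {x y} → ⟨ S ⟩ x → ⟨ S ⟩ y → ⟨ S ⟩ (x · y)
    inv  : ∀ {x} → ⟨ S ⟩ x → ⟨ S ⟩ (x ⁻¹)

  IsSubgroup : Subset → Set
  IsSubgroup H = (ε ∈ H)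
               × (∀ {x y} → x ∈ H → y ∈ H → (x · y) ∈ H)
               × (∀ {x} → x ∈ H → (x ⁻¹) ∈ H)

  ConjInvariant : Subset → Set
  ConjInvariant X = ∀ {x} a → x ∈ X → conj x a ∈ X

  IsNormal : Subset → Set
  IsNormal H = IsSubgroup H × ConjInvariant H

  IsNormalIn : Subset → Subset → Set
  IsNormalIn N K = IsSubgroup N × (N ⊆ K) × (∀ {x} a → a ∈ K → x ∈ N → conj x a ∈ N)

  [_,_] : Subset → Subset → Subset
  [ X , Y ] = ⟨ (λ z → ∃[ x ] ∃[ y ] (x ∈ X × y ∈ Y × z ≡ comm x y)) ⟩

  [_,[_]_] : Subset → ℕ → Subset → Subset
  [ X ,[ zero ] Y ] = X
  [ X ,[ suc k ] Y ] = [ [ X ,[ k ] Y ] , Y ]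

  class : Carrier → Subset
  class g x = ∃[ a ] (x ≡ conj g a)

  AdmissibleM : ℕ → Set₁
  AdmissibleM M = ∀ (X Y : Subset) → ConjInvariant X → ConjInvariant Y →
                  ∀ i → M ≤ i → [ X ,[ M ] Y ] ≐ [ X ,[ i ] Y ]

  η : ℕ → Carrier → Subset → Subset
  η M g N = [ N ,[ M ] class g ]

  _⋆_ : Subset → Subset → Subset
  (X ⋆ Y) z = ∃[ x ] ∃[ y ] (x ∈ X × y ∈ Y × z ≡ x · y)

  whole : Subset
  whole _ = Data.Unit.⊤
    where import Data.Unit

  trivial : Subset
  trivial x = x ≡ ε

  derived : ℕ → Subset
  derived zero = whole
  derived (suc n) = [ derived n , derived n ]

  Solvable : Set
  Solvable = ∃[ n ] (derived n ⊆ trivial)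

  -- A/B nilpotent (for B ⊴ A ≤ G): some term γ_{c+1}(A) = [A,_c A] of the
  -- lower central series of A lies in B (equivalently γ_{c+1}(A/B) = 1)
  NilpotentFactor : Subset → Subset → Set
  NilpotentFactor A B = ∃[ c ] ([ A ,[ c ] A ] ⊆ B)

  HasFittingSeries : Subset → ℕ → Set₁
  HasFittingSeries K d =
    Σ (ℕ → Subset) λ S →
      (S 0 ≐ trivial) × (S d ≐ K)
      × (∀ i → i ≤ d → IsNormalIn (S i) K)
      × (∀ i → i < d → S i ⊆ S (suc i))
      × (∀ i → i < d → NilpotentFactor (S (suc i)) (S i))

  FittingLength : Subset → ℕ → Set₁
  FittingLength K d = HasFittingSeries K d × (∀ e → HasFittingSeries K e → d ≤ e)

-- Write C = (gh)^G, X = g^G, Y = h^G, so that C ⊆ XY.  The identity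
-- [u, xy] = [u, y] [u^y, x^y] shows that commutation with an element of C
-- raises by one the total degree of the subgroups generated by the sets
-- P_p ∩ Q_q, where P and Q are families of normal subgroups with
-- [P_p, X] ≤ P_{p+1} and [Q_q, Y] ≤ Q_{q+1}.  Taking P_p = [H, _p X] and
-- Q_q = [H, _q Y], the subgroup η_{gh}(H) = [H, _{2M} C] lies in the
-- subgroup generated by the P_p ∩ Q_q with p + q = 2M, each contained in
-- η_g(H) or η_h(H); this is (ii), and (i) is the stabilisation of the
-- iterated commutators.  For (iii), the nilpotent residuals R(N) = [N, _M N]
-- satisfy R^i(N) ≤ R^i(A) R^i(B) whenever N ≤ AB (by the same argument, with
-- P and Q the lower central series of A and B), and a normal subgroup N has
-- Fitting length at most d exactly when R^d(N) = 1.

module Submission where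

open import Defs
open import Data.Nat using (ℕ; _≤_; _⊔_)
open import Data.Product using (_×_)
open import Relation.Unary using (_⊆_)

open import Data.Nat using (zero; suc; _+_; _∸_; _<_; z≤n; s≤s; _≤?_; _≤′_; ≤′-refl; ≤′-step)
open import Data.Nat.Properties
  using (+-suc; +-comm; +-identityʳ; +-mono-≤; m≤n+m; ≤⇒≤′; m≤m+n; m≤m⊔n; m≤n⊔m;
         n≤1+n; m≤n⇒m≤1+n; n∸n≡0; ∸-monoʳ-≤; ≤-trans; ≤-reflexive; ≰⇒>; <⇒≱)
open import Data.Fin using (Fin) renaming (zero to fzero; suc to fsuc)
open import Data.Fin.Properties using (_≟_)
open import Data.Vec using (Vec; []; _∷_; lookup)
open import Data.Bool using (Bool; true; false; not)
open import Data.List using (List; []; _∷_)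
open import Data.Product using (_,_; proj₁; proj₂; ∃-syntax)
open import Function using (_∘_; case_of_)
open import Data.Sum using (_⊎_; inj₁; inj₂)
open import Data.Unit using (tt)
open import Relation.Nullary using (yes; no; contradiction)
open import Relation.Unary using (_∈_)
open import Relation.Binary.PropositionalEquality hiding ([_])
open import Algebra.Core using (Op₁; Op₂)
open import Algebra.Structures using (IsGroup)
open import Algebra.Bundles using (Group)
import Algebra.Properties.Group as GroupProperties

m+m≤1+p+q⇒m≤p⊎m≤q : ∀ m p q → m + m ≤ suc (p + q) → m ≤ p ⊎ m ≤ q
m+m≤1+p+q⇒m≤p⊎m≤q m p q m+m≤1+p+q with m ≤? p | m ≤? q
... | yes m≤p | _       = inj₁ m≤p
... | no _    | yes m≤q = inj₂ m≤q
... | no m≰p  | no m≰q  = contradiction m+m≤1+p+q (<⇒≱ 1+p+q<m+m)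
  where
  1+p+q<m+m : suc (p + q) < m + m
  1+p+q<m+m = ≤-trans (s≤s (≤-reflexive (sym (+-suc p q)))) (+-mono-≤ (≰⇒> m≰p) (≰⇒> m≰q))

m∸n≡suc[m∸suc[n]] : ∀ {m n} → n < m → m ∸ n ≡ suc (m ∸ suc n)
m∸n≡suc[m∸suc[n]] {suc m} {zero}  _         = refl
m∸n≡suc[m∸suc[n]] {suc m} {suc n} (s≤s n<m) = m∸n≡suc[m∸suc[n]] n<m

-- Equalities between group words are decided by free reduction: a term
-- evaluates to the product of the literals of its freely reduced word.
module GroupWords {A : Set} {_∙_ : Op₂ A} {ε : A} {_⁻¹ : Op₁ A}
                  (isGroup : IsGroup _≡_ _∙_ ε _⁻¹) where
  open IsGroup isGroup using (assoc; identityˡ; identityʳ; inverseˡ; inverseʳ)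

  private
    group : Group _ _
    group = record { isGroup = isGroup }

  open GroupProperties group using (ε⁻¹≈ε; ⁻¹-involutive; ⁻¹-anti-homo-∙)

  infixl 7 _⊗_
  infix  8 _⁻ᵗ
  data Term (n : ℕ) : Set where
    var : Fin n → Term n
    _⊗_ : Term n → Term n → Term n
    _⁻ᵗ : Term n → Term n
    1ᵗ  : Term n

  conjᵗ commᵗ : ∀ {n} → Term n → Term n → Term n
  conjᵗ s t = (t ⁻ᵗ ⊗ s) ⊗ t
  commᵗ s t = ((s ⁻ᵗ ⊗ t ⁻ᵗ) ⊗ s) ⊗ t

  x₀ : ∀ {n} → Term (1 + n)
  x₀ = var fzero
  x₁ : ∀ {n} → Term (2 + n)
  x₁ = var (fsuc fzero)
  x₂ : ∀ {n} → Term (3 + n)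
  x₂ = var (fsuc (fsuc fzero))
  x₃ : ∀ {n} → Term (4 + n)
  x₃ = var (fsuc (fsuc (fsuc fzero)))

  ⟦_⟧ : ∀ {n} → Term n → Vec A n → A
  ⟦ var i ⟧ ρ = lookup ρ i
  ⟦ s ⊗ t ⟧ ρ = (⟦ s ⟧ ρ) ∙ (⟦ t ⟧ ρ)
  ⟦ s ⁻ᵗ ⟧  ρ = (⟦ s ⟧ ρ) ⁻¹
  ⟦ 1ᵗ ⟧    ρ = ε

  -- (true , i) stands for the i-th variable, (false , i) for its inverse.
  Literal : ℕ → Set
  Literal n = Bool × Fin n

  Word : ℕ → Set
  Word n = List (Literal n)

  cancelʳ : ∀ x y → x ∙ ((x ⁻¹) ∙ y) ≡ y
  cancelʳ x y = trans (sym (assoc _ _ _)) (trans (cong (_∙ y) (inverseʳ x)) (identityˡ y))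

  cancelˡ : ∀ x y → (x ⁻¹) ∙ (x ∙ y) ≡ y
  cancelˡ x y = trans (sym (assoc _ _ _)) (trans (cong (_∙ y) (inverseˡ x)) (identityˡ y))

  module _ {n : ℕ} where
    cons : Literal n → Word n → Word n
    cons l [] = l ∷ []
    cons (b , i) ((c , j) ∷ w) with i ≟ j
    cons (true  , i) ((false , j) ∷ w) | yes _ = w
    cons (false , i) ((true  , j) ∷ w) | yes _ = w
    cons l (m ∷ w) | _ = l ∷ m ∷ w

    _++ʷ_ : Word n → Word n → Word n
    []      ++ʷ w = w
    (l ∷ v) ++ʷ w = cons l (v ++ʷ w)

    invert : Literal n → Literal n
    invert (b , i) = (not b , i)

    reverseInverse : Word n → Word n
    reverseInverse []      = []
    reverseInverse (l ∷ w) = reverseInverse w ++ʷ (invert l ∷ [])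

    normalise : Term n → Word n
    normalise (var i) = (true , i) ∷ []
    normalise (s ⊗ t) = normalise s ++ʷ normalise t
    normalise (s ⁻ᵗ)  = reverseInverse (normalise s)
    normalise 1ᵗ      = []

    module _ (ρ : Vec A n) where
      ⟦_⟧ˡ : Literal n → A
      ⟦ true  , i ⟧ˡ = lookup ρ i
      ⟦ false , i ⟧ˡ = (lookup ρ i) ⁻¹

      ⟦_⟧ʷ : Word n → A
      ⟦ [] ⟧ʷ    = ε
      ⟦ l ∷ w ⟧ʷ = ⟦ l ⟧ˡ ∙ ⟦ w ⟧ʷ

      cons-sound : ∀ l w → ⟦ cons l w ⟧ʷ ≡ ⟦ l ⟧ˡ ∙ ⟦ w ⟧ʷ
      cons-sound l [] = refl
      cons-sound (b , i) ((c , j) ∷ w) with i ≟ j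
      cons-sound (true  , i) ((false , .i) ∷ w) | yes refl = sym (cancelʳ _ _)
      cons-sound (false , i) ((true  , .i) ∷ w) | yes refl = sym (cancelˡ _ _)
      cons-sound (true  , i) ((true  , j) ∷ w)  | yes _ = refl
      cons-sound (false , i) ((false , j) ∷ w)  | yes _ = refl
      ... | no _ = refl

      ++ʷ-sound : ∀ v w → ⟦ v ++ʷ w ⟧ʷ ≡ ⟦ v ⟧ʷ ∙ ⟦ w ⟧ʷ
      ++ʷ-sound []      w = sym (identityˡ _)
      ++ʷ-sound (l ∷ v) w = begin
        ⟦ cons l (v ++ʷ w) ⟧ʷ     ≡⟨ cons-sound l (v ++ʷ w) ⟩
        ⟦ l ⟧ˡ ∙ ⟦ v ++ʷ w ⟧ʷ     ≡⟨ cong (⟦ l ⟧ˡ ∙_) (++ʷ-sound v w) ⟩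
        ⟦ l ⟧ˡ ∙ (⟦ v ⟧ʷ ∙ ⟦ w ⟧ʷ) ≡⟨ sym (assoc _ _ _) ⟩
        (⟦ l ⟧ˡ ∙ ⟦ v ⟧ʷ) ∙ ⟦ w ⟧ʷ ∎
        where open ≡-Reasoning

      invert-sound : ∀ l → ⟦ invert l ⟧ˡ ≡ ⟦ l ⟧ˡ ⁻¹
      invert-sound (true  , i) = refl
      invert-sound (false , i) = sym (⁻¹-involutive _)

      reverseInverse-sound : ∀ w → ⟦ reverseInverse w ⟧ʷ ≡ ⟦ w ⟧ʷ ⁻¹
      reverseInverse-sound []      = sym ε⁻¹≈ε
      reverseInverse-sound (l ∷ w) = begin
        ⟦ reverseInverse w ++ʷ (invert l ∷ []) ⟧ʷ ≡⟨ ++ʷ-sound (reverseInverse w) (invert l ∷ []) ⟩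
        ⟦ reverseInverse w ⟧ʷ ∙ (⟦ invert l ⟧ˡ ∙ ε) ≡⟨ cong₂ _∙_ (reverseInverse-sound w) (identityʳ _) ⟩
        (⟦ w ⟧ʷ ⁻¹) ∙ ⟦ invert l ⟧ˡ                ≡⟨ cong ((⟦ w ⟧ʷ ⁻¹) ∙_) (invert-sound l) ⟩
        (⟦ w ⟧ʷ ⁻¹) ∙ (⟦ l ⟧ˡ ⁻¹)                  ≡⟨ sym (⁻¹-anti-homo-∙ _ _) ⟩
        (⟦ l ⟧ˡ ∙ ⟦ w ⟧ʷ) ⁻¹                       ∎
        where open ≡-Reasoning

      normalise-sound : ∀ t → ⟦ t ⟧ ρ ≡ ⟦ normalise t ⟧ʷ
      normalise-sound (var i) = sym (identityʳ _)
      normalise-sound (s ⊗ t) =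
        trans (cong₂ _∙_ (normalise-sound s) (normalise-sound t)) (sym (++ʷ-sound (normalise s) (normalise t)))
      normalise-sound (s ⁻ᵗ) =
        trans (cong _⁻¹ (normalise-sound s)) (sym (reverseInverse-sound (normalise s)))
      normalise-sound 1ᵗ = refl

  solve : ∀ {n} (s t : Term n) → normalise s ≡ normalise t → (ρ : Vec A n) → ⟦ s ⟧ ρ ≡ ⟦ t ⟧ ρ
  solve s t s≈t ρ = trans (normalise-sound ρ s) (trans (cong (⟦_⟧ʷ ρ) s≈t) (sym (normalise-sound ρ t)))

module Commutators (G : FiniteGroup) where
  open GroupTheory G
  open IsGroup isGroup using (identityˡ; identityʳ)
  open GroupWords isGroup

  conj-· : ∀ x y a → conj (x · y) a ≡ conj x a · conj y a
  conj-· x y a = solve (conjᵗ (x₀ ⊗ x₁) x₂) (conjᵗ x₀ x₂ ⊗ conjᵗ x₁ x₂) refl (x ∷ y ∷ a ∷ [])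

  conj-⁻¹ : ∀ x a → conj (x ⁻¹) a ≡ conj x a ⁻¹
  conj-⁻¹ x a = solve (conjᵗ (x₀ ⁻ᵗ) x₁) (conjᵗ x₀ x₁ ⁻ᵗ) refl (x ∷ a ∷ [])

  conj-ε : ∀ a → conj ε a ≡ ε
  conj-ε a = solve (conjᵗ 1ᵗ x₀) 1ᵗ refl (a ∷ [])

  conj-conj : ∀ x a b → conj (conj x a) b ≡ conj x (a · b)
  conj-conj x a b = solve (conjᵗ (conjᵗ x₀ x₁) x₂) (conjᵗ x₀ (x₁ ⊗ x₂)) refl (x ∷ a ∷ b ∷ [])

  conj-comm : ∀ x y a → conj (comm x y) a ≡ comm (conj x a) (conj y a)
  conj-comm x y a = solve (conjᵗ (commᵗ x₀ x₁) x₂) (commᵗ (conjᵗ x₀ x₂) (conjᵗ x₁ x₂)) refl (x ∷ y ∷ a ∷ [])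

  comm≡⁻¹·conj : ∀ u x → comm u x ≡ u ⁻¹ · conj u x
  comm≡⁻¹·conj u x = solve (commᵗ x₀ x₁) (x₀ ⁻ᵗ ⊗ conjᵗ x₀ x₁) refl (u ∷ x ∷ [])

  comm≡conj· : ∀ u x → comm u x ≡ conj (x ⁻¹) u · x
  comm≡conj· u x = solve (commᵗ x₀ x₁) (conjᵗ (x₁ ⁻ᵗ) x₀ ⊗ x₁) refl (u ∷ x ∷ [])

  comm-ε : ∀ x → comm ε x ≡ ε
  comm-ε x = solve (commᵗ 1ᵗ x₀) 1ᵗ refl (x ∷ [])

  comm-·ˡ : ∀ u v x → comm (u · v) x ≡ conj (comm u x) v · comm v x
  comm-·ˡ u v x = solve (commᵗ (x₀ ⊗ x₁) x₂) (conjᵗ (commᵗ x₀ x₂) x₁ ⊗ commᵗ x₁ x₂) refl (u ∷ v ∷ x ∷ [])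

  comm-⁻¹ˡ : ∀ u x → comm (u ⁻¹) x ≡ conj (comm u x ⁻¹) (u ⁻¹)
  comm-⁻¹ˡ u x = solve (commᵗ (x₀ ⁻ᵗ) x₁) (conjᵗ (commᵗ x₀ x₁ ⁻ᵗ) (x₀ ⁻ᵗ)) refl (u ∷ x ∷ [])

  comm-·ʳ : ∀ u x y → comm u (x · y) ≡ comm u y · comm (conj u y) (conj x y)
  comm-·ʳ u x y = solve (commᵗ x₀ (x₁ ⊗ x₂)) (commᵗ x₀ x₂ ⊗ commᵗ (conjᵗ x₀ x₂) (conjᵗ x₁ x₂)) refl (u ∷ x ∷ y ∷ [])

  ·-·-interchange : ∀ a b c d → (a · b) · (c · d) ≡ (a · conj c (b ⁻¹)) · (b · d)
  ·-·-interchange a b c d = solve ((x₀ ⊗ x₁) ⊗ (x₂ ⊗ x₃)) ((x₀ ⊗ conjᵗ x₂ (x₁ ⁻ᵗ)) ⊗ (x₁ ⊗ x₃)) refl (a ∷ b ∷ c ∷ d ∷ [])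

  ·-⁻¹-interchange : ∀ a b → (a · b) ⁻¹ ≡ conj (a ⁻¹) b · b ⁻¹
  ·-⁻¹-interchange a b = solve ((x₀ ⊗ x₁) ⁻ᵗ) (conjᵗ (x₀ ⁻ᵗ) x₁ ⊗ x₁ ⁻ᵗ) refl (a ∷ b ∷ [])

  module _ {X : Subset} (X≤G : IsSubgroup X) where
    ε∈ : ε ∈ X
    ε∈ = proj₁ X≤G

    ·∈ : ∀ {x y} → x ∈ X → y ∈ X → x · y ∈ X
    ·∈ = proj₁ (proj₂ X≤G)

    ⁻¹∈ : ∀ {x} → x ∈ X → x ⁻¹ ∈ X
    ⁻¹∈ = proj₂ (proj₂ X≤G)

  ⟨⟩-isSubgroup : ∀ {S} → IsSubgroup ⟨ S ⟩
  ⟨⟩-isSubgroup = unit , mul , inv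

  ⟨⟩-least : ∀ {S T} → S ⊆ T → IsSubgroup T → ⟨ S ⟩ ⊆ T
  ⟨⟩-least S⊆T T≤G (gen s)   = S⊆T s
  ⟨⟩-least S⊆T T≤G unit      = ε∈ T≤G
  ⟨⟩-least S⊆T T≤G (mul s t) = ·∈ T≤G (⟨⟩-least S⊆T T≤G s) (⟨⟩-least S⊆T T≤G t)
  ⟨⟩-least S⊆T T≤G (inv s)   = ⁻¹∈ T≤G (⟨⟩-least S⊆T T≤G s)

  Invariant : Subset → Subset → Set
  Invariant P X = ∀ {a x} → a ∈ P → x ∈ X → conj x a ∈ X

  conjInvariant⇒invariant : ∀ {P X} → ConjInvariant X → Invariant P X
  conjInvariant⇒invariant X⊴G {a} {x} _ x∈X = X⊴G {x} a x∈X

  invariant⇒conjInvariant : ∀ {X} → Invariant whole X → ConjInvariant X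
  invariant⇒conjInvariant X-inv {x} a = X-inv {a} {x} tt

  subgroup-invariant : ∀ {X} → IsSubgroup X → Invariant X X
  subgroup-invariant X≤G a∈X x∈X = ·∈ X≤G (·∈ X≤G (⁻¹∈ X≤G a∈X) x∈X) a∈X

  ⟨⟩-invariant : ∀ {P S} → Invariant P S → Invariant P ⟨ S ⟩
  ⟨⟩-invariant S-inv a∈P (gen s) = gen (S-inv a∈P s)
  ⟨⟩-invariant S-inv {a} a∈P unit =
    subst ⟨ _ ⟩ (sym (conj-ε a)) unit
  ⟨⟩-invariant S-inv {a} a∈P (mul {x} {y} s t) =
    subst ⟨ _ ⟩ (sym (conj-· x y a)) (mul (⟨⟩-invariant S-inv a∈P s) (⟨⟩-invariant S-inv a∈P t))
  ⟨⟩-invariant S-inv {a} a∈P (inv {x} s) =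
    subst ⟨ _ ⟩ (sym (conj-⁻¹ x a)) (inv (⟨⟩-invariant S-inv a∈P s))

  ⟨⟩-normal : ∀ {S} → ConjInvariant S → IsNormal ⟨ S ⟩
  ⟨⟩-normal {S} S⊴G =
    ⟨⟩-isSubgroup , invariant⇒conjInvariant {⟨ S ⟩} (⟨⟩-invariant (conjInvariant⇒invariant {whole} {S} S⊴G))

  [,]-invariant : ∀ {P X Y} → Invariant P X → Invariant P Y → Invariant P [ X , Y ]
  [,]-invariant {P} {X} {Y} X-inv Y-inv = ⟨⟩-invariant generators-invariant
    where
    generators-invariant : Invariant P (λ z → ∃[ x ] ∃[ y ] (x ∈ X × y ∈ Y × z ≡ comm x y))
    generators-invariant {a} a∈P (x , y , x∈X , y∈Y , refl) =
      conj x a , conj y a , X-inv a∈P x∈X , Y-inv a∈P y∈Y , conj-comm x y a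

  [,[]]-invariant : ∀ {P X Y} → Invariant P X → Invariant P Y → ∀ k → Invariant P [ X ,[ k ] Y ]
  [,[]]-invariant X-inv Y-inv zero    = X-inv
  [,[]]-invariant X-inv Y-inv (suc k) = [,]-invariant ([,[]]-invariant X-inv Y-inv k) Y-inv

  [,[]]-isSubgroup : ∀ {X Y} → IsSubgroup X → ∀ k → IsSubgroup [ X ,[ k ] Y ]
  [,[]]-isSubgroup X≤G zero    = X≤G
  [,[]]-isSubgroup X≤G (suc k) = ⟨⟩-isSubgroup

  [,[]]-normal : ∀ {X Y} → IsNormal X → ConjInvariant Y → ∀ k → IsNormal [ X ,[ k ] Y ]
  [,[]]-normal {X} {Y} (X≤G , X⊴G) Y⊴G k =
      [,[]]-isSubgroup X≤G k
    , invariant⇒conjInvariant {[ X ,[ k ] Y ]}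
        ([,[]]-invariant (conjInvariant⇒invariant {whole} {X} X⊴G) (conjInvariant⇒invariant {whole} {Y} Y⊴G) k)

  [,]-mono : ∀ {X₁ X₂ Y₁ Y₂} → X₁ ⊆ X₂ → Y₁ ⊆ Y₂ → [ X₁ , Y₁ ] ⊆ [ X₂ , Y₂ ]
  [,]-mono X₁⊆X₂ Y₁⊆Y₂ = ⟨⟩-least (λ (x , y , x∈ , y∈ , z≡) → gen (x , y , X₁⊆X₂ x∈ , Y₁⊆Y₂ y∈ , z≡)) ⟨⟩-isSubgroup

  [,[]]-mono : ∀ {X₁ X₂ Y₁ Y₂} → X₁ ⊆ X₂ → Y₁ ⊆ Y₂ → ∀ k → [ X₁ ,[ k ] Y₁ ] ⊆ [ X₂ ,[ k ] Y₂ ]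
  [,[]]-mono X₁⊆X₂ Y₁⊆Y₂ zero    = X₁⊆X₂
  [,[]]-mono X₁⊆X₂ Y₁⊆Y₂ (suc k) = [,]-mono ([,[]]-mono X₁⊆X₂ Y₁⊆Y₂ k) Y₁⊆Y₂

  [,[]]-+ : ∀ {X Y} k c → [ [ X ,[ c ] Y ] ,[ k ] Y ] ≡ [ X ,[ k + c ] Y ]
  [,[]]-+ zero    c = refl
  [,[]]-+ (suc k) c = cong [_, _ ] ([,[]]-+ k c)

  [,]-⊆ˡ : ∀ {P X Y} → IsSubgroup X → Invariant P X → Y ⊆ P → [ X , Y ] ⊆ X
  [,]-⊆ˡ {X = X} X≤G X-inv Y⊆P = ⟨⟩-least (λ where
    (x , y , x∈X , y∈Y , refl) →
      subst X (sym (comm≡⁻¹·conj x y)) (·∈ X≤G (⁻¹∈ X≤G x∈X) (X-inv (Y⊆P y∈Y) x∈X))) X≤G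

  [,[]]-⊆ˡ : ∀ {P X Y} → IsSubgroup X → Invariant P X → Y ⊆ P → ∀ k → [ X ,[ k ] Y ] ⊆ X
  [,[]]-⊆ˡ X≤G X-inv Y⊆P zero    = λ x∈X → x∈X
  [,[]]-⊆ˡ X≤G X-inv Y⊆P (suc k) =
    [,]-⊆ˡ X≤G X-inv Y⊆P ∘ [,]-mono ([,[]]-⊆ˡ X≤G X-inv Y⊆P k) (λ y∈Y → y∈Y)

  normal-comm∈ : ∀ {N u} x → IsNormal N → u ∈ N → comm u x ∈ N
  normal-comm∈ {N} {u} x (N≤G , N⊴G) u∈N =
    subst N (sym (comm≡⁻¹·conj u x)) (·∈ N≤G (⁻¹∈ N≤G u∈N) (N⊴G x u∈N))

  ⟨⟩-comm∈ : ∀ {N S} x → IsNormal N → (∀ {u} → u ∈ S → comm u x ∈ N) →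
             ∀ {u} → u ∈ ⟨ S ⟩ → comm u x ∈ N
  ⟨⟩-comm∈ x N⊴G S-comm (gen u∈S) = S-comm u∈S
  ⟨⟩-comm∈ {N} x (N≤G , N⊴G) S-comm unit =
    subst N (sym (comm-ε x)) (ε∈ N≤G)
  ⟨⟩-comm∈ {N} x (N≤G , N⊴G) S-comm (mul {u} {v} u∈ v∈) =
    subst N (sym (comm-·ˡ u v x))
      (·∈ N≤G (N⊴G v (⟨⟩-comm∈ x (N≤G , N⊴G) S-comm u∈)) (⟨⟩-comm∈ x (N≤G , N⊴G) S-comm v∈))
  ⟨⟩-comm∈ {N} x (N≤G , N⊴G) S-comm (inv {u} u∈) =
    subst N (sym (comm-⁻¹ˡ u x)) (N⊴G (u ⁻¹) (⁻¹∈ N≤G (⟨⟩-comm∈ x (N≤G , N⊴G) S-comm u∈)))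

  ⋆-isSubgroup : ∀ {A B} → IsNormal A → IsSubgroup B → IsSubgroup (A ⋆ B)
  ⋆-isSubgroup (A≤G , A⊴G) B≤G =
      (ε , ε , ε∈ A≤G , ε∈ B≤G , sym (identityˡ ε))
    , (λ where
         (a , b , a∈ , b∈ , refl) (c , d , c∈ , d∈ , refl) →
           a · conj c (b ⁻¹) , b · d , ·∈ A≤G a∈ (A⊴G (b ⁻¹) c∈) , ·∈ B≤G b∈ d∈ , ·-·-interchange a b c d)
    , (λ where
         (a , b , a∈ , b∈ , refl) →
           conj (a ⁻¹) b , b ⁻¹ , A⊴G b (⁻¹∈ A≤G a∈) , ⁻¹∈ B≤G b∈ , ·-⁻¹-interchange a b)

  ⊆-⋆ˡ : ∀ {A B} → ε ∈ B → A ⊆ A ⋆ B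
  ⊆-⋆ˡ ε∈B {a} a∈A = a , ε , a∈A , ε∈B , sym (identityʳ a)

  ⊆-⋆ʳ : ∀ {A B} → ε ∈ A → B ⊆ A ⋆ B
  ⊆-⋆ʳ ε∈A {b} b∈B = ε , b , ε∈A , b∈B , sym (identityˡ b)

  class-conjInvariant : ∀ g → ConjInvariant (class g)
  class-conjInvariant g b (a , refl) = a · b , conj-conj g a b

  class-·-⊆ : ∀ g h → class (g · h) ⊆ class g ⋆ class h
  class-·-⊆ g h (a , refl) = conj g a , conj h a , (a , refl) , (a , refl) , conj-· g h a

  whole-normal : IsNormal whole
  whole-normal = (tt , (λ _ _ → tt) , (λ _ → tt)) , (λ _ _ → tt)

  -- The lower central series of X, indexed so that γ X 1 = X; the extra term γ X 0 = G
  -- lets an element of X count as having degree 1 in γ X and degree 0 in γ Y.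
  γ : Subset → ℕ → Subset
  γ X zero    = whole
  γ X (suc p) = [ X ,[ p ] X ]

  γ-normal : ∀ {X} → IsNormal X → ∀ p → IsNormal (γ X p)
  γ-normal X⊴G zero    = whole-normal
  γ-normal X⊴G (suc p) = [,[]]-normal X⊴G (proj₂ X⊴G) p

  γ-comm∈ : ∀ {X} → IsNormal X → ∀ p {u x} → u ∈ γ X p → x ∈ X → comm u x ∈ γ X (suc p)
  γ-comm∈ {X} (X≤G , X⊴G) zero {u} {x} _ x∈X =
    subst X (sym (comm≡conj· u x)) (·∈ X≤G (X⊴G u (⁻¹∈ X≤G x∈X)) x∈X)
  γ-comm∈ X⊴G (suc p) u∈ x∈X = gen (_ , _ , u∈ , x∈X , refl)

  module Interleaving
      (P Q : ℕ → Subset) (P⊴G : ∀ p → IsNormal (P p)) (Q⊴G : ∀ q → IsNormal (Q q))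
      (X Y : Subset) (X⊴G : ConjInvariant X) (Y⊴G : ConjInvariant Y)
      (P-comm∈ : ∀ p {u x} → u ∈ P p → x ∈ X → comm u x ∈ P (suc p))
      (Q-comm∈ : ∀ q {u y} → u ∈ Q q → y ∈ Y → comm u y ∈ Q (suc q)) where

    Mixed : ℕ → Subset
    Mixed n z = ∃[ p ] ∃[ q ] (p + q ≡ n × z ∈ P p × z ∈ Q q)

    ⟨Mixed⟩-normal : ∀ n → IsNormal ⟨ Mixed n ⟩
    ⟨Mixed⟩-normal n = ⟨⟩-normal λ a (p , q , p+q≡n , z∈P , z∈Q) →
      p , q , p+q≡n , proj₂ (P⊴G p) a z∈P , proj₂ (Q⊴G q) a z∈Q

    -- [u, x y] = [u, y] [u^y, x^y]: the first factor gains a degree in Q, the second in P.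
    ⟨Mixed⟩-comm∈ : ∀ n {x y u} → x ∈ X → y ∈ Y → u ∈ ⟨ Mixed n ⟩ → comm u (x · y) ∈ ⟨ Mixed (suc n) ⟩
    ⟨Mixed⟩-comm∈ n {x} {y} x∈X y∈Y = ⟨⟩-comm∈ (x · y) (⟨Mixed⟩-normal (suc n)) generator-case
      where
      generator-case : ∀ {u} → u ∈ Mixed n → comm u (x · y) ∈ ⟨ Mixed (suc n) ⟩
      generator-case {u} (p , q , refl , u∈P , u∈Q) =
        subst ⟨ Mixed (suc (p + q)) ⟩ (sym (comm-·ʳ u x y))
          (mul (gen (p , suc q , +-suc p q , normal-comm∈ y (P⊴G p) u∈P , Q-comm∈ q u∈Q y∈Y))
               (gen (suc p , q , refl , P-comm∈ p (proj₂ (P⊴G p) y u∈P) (X⊴G y x∈X)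
                    , normal-comm∈ (conj x y) (Q⊴G q) (proj₂ (Q⊴G q) y u∈Q))))

    [,[]]-⊆-⟨Mixed⟩ : ∀ {C Z} s → C ⊆ X ⋆ Y → Z ⊆ ⟨ Mixed s ⟩ → ∀ k → [ Z ,[ k ] C ] ⊆ ⟨ Mixed (k + s) ⟩
    [,[]]-⊆-⟨Mixed⟩ s C⊆XY Z⊆ zero    = Z⊆
    [,[]]-⊆-⟨Mixed⟩ s C⊆XY Z⊆ (suc k) = ⟨⟩-least (λ where
      (u , c , u∈ , c∈C , refl) → case C⊆XY c∈C of λ where
        (x , y , x∈X , y∈Y , refl) → ⟨Mixed⟩-comm∈ (k + s) x∈X y∈Y ([,[]]-⊆-⟨Mixed⟩ s C⊆XY Z⊆ k u∈))
      ⟨⟩-isSubgroup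

    ⟨Mixed⟩-⊆-⋆ : ∀ {A B} m n → IsNormal A → IsNormal B →
                  (∀ {p} → m ≤ p → P p ⊆ A) → (∀ {q} → m ≤ q → Q q ⊆ B) →
                  m + m ≤ suc n → ⟨ Mixed n ⟩ ⊆ A ⋆ B
    ⟨Mixed⟩-⊆-⋆ m n A⊴G B⊴G P⊆A Q⊆B m+m≤1+n =
      ⟨⟩-least (λ where
        (p , q , refl , z∈P , z∈Q) → case m+m≤1+p+q⇒m≤p⊎m≤q m p q m+m≤1+n of λ where
          (inj₁ m≤p) → ⊆-⋆ˡ (ε∈ (proj₁ B⊴G)) (P⊆A m≤p z∈P)
          (inj₂ m≤q) → ⊆-⋆ʳ (ε∈ (proj₁ A⊴G)) (Q⊆B m≤q z∈Q))
        (⋆-isSubgroup A⊴G (proj₁ B⊴G))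

  ≡⇒⊆ : ∀ {A B : Subset} → A ≡ B → A ⊆ B
  ≡⇒⊆ refl z∈A = z∈A

  module Admissible (M : ℕ) (admissible : AdmissibleM M) where

    stable-⊆ : ∀ {X Y i} → ConjInvariant X → ConjInvariant Y → M ≤ i → [ X ,[ i ] Y ] ⊆ [ X ,[ M ] Y ]
    stable-⊆ {X} {Y} {i} X⊴G Y⊴G M≤i = proj₂ (admissible X Y X⊴G Y⊴G i M≤i)

    ⊆-stable : ∀ {X Y} i → ConjInvariant X → ConjInvariant Y → M ≤ i → [ X ,[ M ] Y ] ⊆ [ X ,[ i ] Y ]
    ⊆-stable {X} {Y} i X⊴G Y⊴G M≤i = proj₁ (admissible X Y X⊴G Y⊴G i M≤i)

    η-normal : ∀ {H} → IsNormal H → ∀ g → IsNormal (η M g H)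
    η-normal H⊴G g = [,[]]-normal H⊴G (class-conjInvariant g) M

    η-idempotent : ∀ {H} → IsNormal H → ∀ g → η M g (η M g H) ≐ η M g H
    η-idempotent (_ , H⊴G) g =
        stable-⊆ H⊴G (class-conjInvariant g) (m≤m+n M M) ∘ ≡⇒⊆ ([,[]]-+ M M)
      , ≡⇒⊆ (sym ([,[]]-+ M M)) ∘ ⊆-stable (M + M) H⊴G (class-conjInvariant g) (m≤m+n M M)

    η-·-⊆ : ∀ {H} → IsNormal H → ∀ g h → η M (g · h) H ⊆ η M g H ⋆ η M h H
    η-·-⊆ {H} H⊴G g h =
        ⟨Mixed⟩-⊆-⋆ M (M + M + 0) (η-normal H⊴G g) (η-normal H⊴G h)
          (stable-⊆ (proj₂ H⊴G) (class-conjInvariant g)) (stable-⊆ (proj₂ H⊴G) (class-conjInvariant h))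
          (m≤n⇒m≤1+n (≤-reflexive (sym (+-identityʳ (M + M)))))
      ∘ [,[]]-⊆-⟨Mixed⟩ 0 (class-·-⊆ g h) (λ z∈H → gen (0 , 0 , refl , z∈H , z∈H)) (M + M)
      ∘ ⊆-stable (M + M) (proj₂ H⊴G) (class-conjInvariant (g · h)) (m≤m+n M M)
      where
      P Q : ℕ → Subset
      P p = [ H ,[ p ] class g ]
      Q q = [ H ,[ q ] class h ]

      open Interleaving P Q ([,[]]-normal H⊴G (class-conjInvariant g)) ([,[]]-normal H⊴G (class-conjInvariant h))
        (class g) (class h) (class-conjInvariant g) (class-conjInvariant h)
        (λ p u∈P x∈X → gen (_ , _ , u∈P , x∈X , refl)) (λ q u∈Q y∈Y → gen (_ , _ , u∈Q , y∈Y , refl))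

    -- By admissibility, residual N 1 = [N, _M N] is the last term of the lower central series of N.
    residual : Subset → ℕ → Subset
    residual N zero    = N
    residual N (suc i) = [ residual N i ,[ M ] residual N i ]

    residual-normal : ∀ {N} → IsNormal N → ∀ i → IsNormal (residual N i)
    residual-normal N⊴G zero    = N⊴G
    residual-normal N⊴G (suc i) = [,[]]-normal R⊴G (proj₂ R⊴G) M
      where R⊴G = residual-normal N⊴G i

    residual-antitone : ∀ {N} → IsNormal N → ∀ {i j} → i ≤ j → residual N j ⊆ residual N i
    residual-antitone {N} N⊴G i≤j = antitone (≤⇒≤′ i≤j)
      where
      antitone : ∀ {i j} → i ≤′ j → residual N j ⊆ residual N i
      antitone ≤′-refl               = λ z∈R → z∈R
      antitone (≤′-step {j} i≤′j) = antitone i≤′j ∘ [,[]]-⊆ˡ R≤G (subgroup-invariant R≤G) (λ z∈R → z∈R) M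
        where R≤G = proj₁ (residual-normal N⊴G j)

    γ-stable : ∀ {X} → ConjInvariant X → ∀ {p} → suc M ≤ p → γ X p ⊆ [ X ,[ M ] X ]
    γ-stable X⊴G {suc p} (s≤s M≤p) = stable-⊆ X⊴G X⊴G M≤p

    [,[M]]-⊆-NilpotentFactor : ∀ {L S T} → IsSubgroup S → ConjInvariant L → L ⊆ S →
                               NilpotentFactor S T → [ L ,[ M ] L ] ⊆ T
    [,[M]]-⊆-NilpotentFactor S≤G L⊴G L⊆S (c , γS⊆T) =
        γS⊆T
      ∘ [,[]]-⊆ˡ ([,[]]-isSubgroup S≤G c) ([,[]]-invariant S-inv S-inv c) (λ s∈S → s∈S) M
      ∘ ≡⇒⊆ (sym ([,[]]-+ M c))
      ∘ [,[]]-mono L⊆S L⊆S (M + c)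
      ∘ ⊆-stable (M + c) L⊴G L⊴G (m≤m+n M c)
      where S-inv = subgroup-invariant S≤G

    series⇒residual-trivial : ∀ {N d} → IsNormal N → HasFittingSeries N d → residual N d ⊆ trivial
    series⇒residual-trivial {N} {d} N⊴G (S , S₀≐1 , S_d≐N , S⊴N , _ , S-nilpotent) =
      proj₁ S₀≐1 ∘ residual-⊆-series d 0 (+-identityʳ d)
      where
      residual-⊆-series : ∀ i j → i + j ≡ d → residual N i ⊆ S j
      residual-⊆-series zero    j refl  = proj₂ S_d≐N
      residual-⊆-series (suc i) j i+j≡d =
        [,[M]]-⊆-NilpotentFactor (proj₁ (S⊴N (suc j) j<d)) (proj₂ (residual-normal N⊴G i))
          (residual-⊆-series i (suc j) (trans (+-suc i j) i+j≡d)) (S-nilpotent j j<d)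
        where
        j<d : j < d
        j<d = subst (suc j ≤_) i+j≡d (s≤s (m≤n+m j i))

    residual-trivial⇒series : ∀ {N} E → IsNormal N → residual N E ⊆ trivial → HasFittingSeries N E
    residual-trivial⇒series {N} E N⊴G R≤1 =
        S
      , (R≤1 , λ { refl → ε∈ (proj₁ (residual-normal N⊴G E)) })
      , subst (λ k → residual N k ≐ N) (sym (n∸n≡0 E)) ((λ z∈N → z∈N) , (λ z∈N → z∈N))
      , (λ i _ → proj₁ (R⊴G i) , residual-antitone N⊴G {j = E ∸ i} z≤n , (λ a _ → proj₂ (R⊴G i) a))
      , (λ i _ → residual-antitone N⊴G (∸-monoʳ-≤ E (n≤1+n i)))
      , (λ i i<E → M , ≡⇒⊆ (cong (residual N) (sym (m∸n≡suc[m∸suc[n]] i<E))))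
      where
      S : ℕ → Subset
      S i = residual N (E ∸ i)

      R⊴G : ∀ i → IsNormal (S i)
      R⊴G i = residual-normal N⊴G (E ∸ i)

    residual-⋆ : ∀ {A B N} → IsNormal A → IsNormal B → IsNormal N → N ⊆ A ⋆ B →
                 ∀ i → residual N i ⊆ residual A i ⋆ residual B i
    residual-⋆ A⊴G B⊴G N⊴G N⊆AB zero = N⊆AB
    residual-⋆ {A} {B} {N} A⊴G B⊴G N⊴G N⊆AB (suc i) =
        ⟨Mixed⟩-⊆-⋆ (suc M) (M + M + 1) (residual-normal A⊴G (suc i)) (residual-normal B⊴G (suc i))
          (γ-stable (proj₂ X⊴G)) (γ-stable (proj₂ Y⊴G))
          (≤-reflexive (cong suc (trans (+-suc M M) (+-comm 1 (M + M)))))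
      ∘ [,[]]-⊆-⟨Mixed⟩ 1 Z⊆XY Z⊆⟨Mixed1⟩ (M + M)
      ∘ ⊆-stable (M + M) Z⊴G Z⊴G (m≤m+n M M)
      where
      X Y Z : Subset
      X = residual A i
      Y = residual B i
      Z = residual N i

      X⊴G = residual-normal A⊴G i
      Y⊴G = residual-normal B⊴G i
      Z⊴G = proj₂ (residual-normal N⊴G i)

      Z⊆XY : Z ⊆ X ⋆ Y
      Z⊆XY = residual-⋆ A⊴G B⊴G N⊴G N⊆AB i

      open Interleaving (γ X) (γ Y) (γ-normal X⊴G) (γ-normal Y⊴G) X Y (proj₂ X⊴G) (proj₂ Y⊴G)
        (γ-comm∈ X⊴G) (γ-comm∈ Y⊴G)

      Z⊆⟨Mixed1⟩ : Z ⊆ ⟨ Mixed 1 ⟩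
      Z⊆⟨Mixed1⟩ z∈Z with Z⊆XY z∈Z
      ... | x , y , x∈X , y∈Y , refl = mul (gen (1 , 0 , refl , x∈X , tt)) (gen (0 , 1 , refl , tt , y∈Y))

    fittingLength-≤-⊔ : ∀ {A B N a b c} → IsNormal A → IsNormal B → IsNormal N → N ⊆ A ⋆ B →
                        FittingLength N a → HasFittingSeries A b → HasFittingSeries B c → a ≤ b ⊔ c
    fittingLength-≤-⊔ {A} {B} {N} {a} {b} {c} A⊴G B⊴G N⊴G N⊆AB (_ , minimal) A-series B-series =
      minimal (b ⊔ c) (residual-trivial⇒series (b ⊔ c) N⊴G R≤1)
      where
      R≤1 : residual N (b ⊔ c) ⊆ trivial
      R≤1 z∈R with residual-⋆ A⊴G B⊴G N⊴G N⊆AB (b ⊔ c) z∈R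
      ... | x , y , x∈ , y∈ , refl = trans
        (cong₂ _·_ (series⇒residual-trivial A⊴G A-series (residual-antitone A⊴G (m≤m⊔n b c) x∈))
                   (series⇒residual-trivial B⊴G B-series (residual-antitone B⊴G (m≤n⊔m b c) y∈)))
        (identityˡ ε)

lemma4p1 : (G : FiniteGroup) → let open GroupTheory G in
    (M : ℕ) → AdmissibleM M →
    (H : Subset) → IsNormal H → (g h : Carrier) →
      (η M g (η M g H) ≐ η M g H)
      × (η M (g · h) H ⊆ (η M g H ⋆ η M h H))
      × (Solvable → (a b c : ℕ) →
           FittingLength (η M (g · h) H) a →
           FittingLength (η M g H) b →
           FittingLength (η M h H) c →
           a ≤ b ⊔ c)
lemma4p1 G M admissible H H⊴G g h =
    η-idempotent H⊴G g
  , η-·-⊆ H⊴G g h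
  , λ _ a b c ℓ-gh ℓ-g ℓ-h →
      fittingLength-≤-⊔ (η-normal H⊴G g) (η-normal H⊴G h) (η-normal H⊴G (g · h)) (η-·-⊆ H⊴G g h)
        ℓ-gh (proj₁ ℓ-g) (proj₁ ℓ-h)
  where
  open GroupTheory G
  open Commutators G
  open Admissible M admissible
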